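{- For every positive integer $n$, the number of $n\times n$ magog matrices with no entry equal to $-1$ is the Catalan number $\frac{1}{n+1}\binom{2n}{n}$.
   Context: An $n\times n$ magog matrix is an $n\times n$ matrix $A=(a_{ij})$ with entries in $\{0,1,-1\}$ such that all row sums and all column sums equal $1$, $0\le \sum_{i'=1}^{i}a_{i'j}\le 1$ for all $1\le i,j\le n$, $\sum_{j'=1}^{j}a_{ij'}\ge 0$ for all $1\le i,j\le n$, and for all $1\le i\le n-2$, $1\le j\le n-2$, $$\sum_{j'=1}^{j}a_{i+1,j'}+\sum_{i'=1}^{i+1}a_{i',j+1}-\sum_{i'=1}^{i}a_{i'j}\ge 0.$$ -}

module Defs where

open import Data.Nat as ℕ using (ℕ; zero; suc; _<_)
open import Data.Nat.Combinatorics using (_C_)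
open import Data.Nat.DivMod using (_/_)
open import Data.Integer as ℤ using (ℤ; +_; -[1+_]; _+_; _-_; _≤_; 0ℤ; 1ℤ)
open import Data.Fin using (Fin; toℕ) renaming (zero to fzero; suc to fsuc)
open import Data.Vec using (Vec; lookup)
open import Data.Sum using (_⊎_)
open import Data.Product using (_×_)
open import Relation.Binary.PropositionalEquality using (_≡_)
open import Relation.Nullary using (¬_)

Matrix : ℕ → Set
Matrix n = Vec (Vec ℤ n) n

entry : ∀ {n} → Matrix n → Fin n → Fin n → ℤ
entry A i j = lookup (lookup A i) j

prefix : ∀ {n} → (Fin n → ℤ) → Fin n → ℤ
prefix f fzero = f fzero
prefix f (fsuc j) = f fzero + prefix (λ k → f (fsuc k)) j

total : ∀ {n} → (Fin n → ℤ) → ℤ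
total {zero} f = 0ℤ
total {suc n} f = f fzero + total (λ k → f (fsuc k))

Row : ∀ {n} → Matrix n → Fin n → Fin n → ℤ
Row A i j = prefix (λ j' → entry A i j') j

Col : ∀ {n} → Matrix n → Fin n → Fin n → ℤ
Col A i j = prefix (λ i' → entry A i' j) i

-1ℤ : ℤ
-1ℤ = -[1+ 0 ]

record IsMagog {n : ℕ} (A : Matrix n) : Set where
  field
    entries   : ∀ i j → entry A i j ≡ 0ℤ ⊎ (entry A i j ≡ 1ℤ ⊎ entry A i j ≡ -1ℤ)
    rowSum    : ∀ i → total (λ j → entry A i j) ≡ 1ℤ
    colSum    : ∀ j → total (λ i → entry A i j) ≡ 1ℤ
    colPrefix : ∀ i j → 0ℤ ≤ Col A i j × Col A i j ≤ 1ℤ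
    rowPrefix : ∀ i j → 0ℤ ≤ Row A i j
    -- for 1-based 1 ≤ i,j ≤ n-2: here i, j 0-based with i' = i+1, j' = j+1,
    -- and the constraint i+1 ≤ n-2 (1-based) becomes suc (toℕ i') < n.
    magogIneq : ∀ (i j i' j' : Fin n) → toℕ i' ≡ suc (toℕ i) → toℕ j' ≡ suc (toℕ j) →
                suc (toℕ i') < n → suc (toℕ j') < n →
                0ℤ ≤ (Row A i' j + Col A i' j') - Col A i j

NoMinusOne : ∀ {n} → Matrix n → Set
NoMinusOne A = ∀ i j → ¬ (entry A i j ≡ -1ℤ)

catalan : ℕ → ℕ
catalan n = ((2 ℕ.* n) C n) / suc n

-- A magog matrix without entries -1 is a permutation matrix, and for it the magog
-- inequality says: if column j is used above row i and row i has its 1 right of column j,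
-- then column j+1 is used in row i or above.  Reading the matrix row by row, the used
-- columns therefore always form {f, …, n-1} minus an increasing list P of pending columns,
-- and the next row uses either a column v below the frontier f (then v+1, …, f-1 become
-- pending) or the first pending column: a stack discipline.  Counting these choices gives
-- the ballot number C(2f+p, f) - C(2f+p, f-1) for f free and p pending columns, and the
-- start f = n, p = 0 gives the Catalan number.

module Submission where

open import Defs
open import Data.Bool using (Bool; true; false; T; _∧_; not)
open import Data.Bool.Properties using (∧-zeroʳ)
open import Data.Fin using (Fin; toℕ; fromℕ<) renaming (zero to fzero; suc to fsuc)
open import Data.Fin.Properties using (toℕ<n; toℕ-fromℕ<)
open import Data.Integer as ℤ using (ℤ; +_; 0ℤ; 1ℤ)
import Data.Integer.Properties as ℤ
open import Data.List as List using (List; []; _∷_; _++_; length)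
import Data.List.Properties as List
open import Data.List.Membership.Propositional using (_∈_; _∉_)
open import Data.List.Membership.Propositional.Properties using (∈-map⁺; ∈-map⁻; ∈-++⁺ˡ; ∈-++⁺ʳ; ∈-++⁻)
open import Data.List.Relation.Unary.All as All using (All)
import Data.List.Relation.Unary.All.Properties as All
import Data.List.Relation.Unary.AllPairs as AllPairs
open import Data.List.Relation.Unary.Any using (here; there)
open import Data.List.Relation.Unary.Unique.Propositional using (Unique)
import Data.List.Relation.Unary.Unique.Propositional.Properties as Unique
open import Data.Nat
open import Data.Nat.Combinatorics using (_C_; nCk+nC[k+1]≡[n+1]C[k+1]; nCk≡nC[n∸k]; nC1≡n; k>n⇒nCk≡0)
open import Data.Nat.DivMod using (_/_; m*n/n≡m)
open import Data.Nat.Properties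
open import Data.Nat.Tactic.RingSolver using (solve-∀)
open import Data.List.Membership.DecPropositional _≟_ using (_∈?_)
open import Data.Product using (Σ; ∃; _×_; _,_; proj₁; proj₂)
open import Data.Sum using (_⊎_; inj₁; inj₂)
open import Data.Unit using (⊤; tt)
open import Data.Vec as Vec using (Vec; []; _∷_; head; lookup; tabulate)
open import Data.Vec.Properties using (∷-injectiveˡ; ∷-injectiveʳ; lookup-map; lookup∘tabulate)
open import Function.Bundles using (_⇔_; mk⇔; Equivalence)
open import Relation.Binary.Definitions using (tri<; tri≈; tri>)
open import Relation.Binary.PropositionalEquality
open import Relation.Nullary using (¬_; yes; no; does; contradiction)
open import Relation.Nullary.Decidable using (dec-true; dec-false; decidable-stable)

-- Ballot numbers

-- completions k f p counts the ways to fill k more rows when the free columns are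
-- 0 … f-1 together with p further free columns above f, the latter to be used in
-- increasing order; completionsBelow k f p counts those whose next column is below f.
completions      : ℕ → ℕ → ℕ → ℕ
completionsBelow : ℕ → ℕ → ℕ → ℕ
completions zero    zero    zero    = 1
completions zero    zero    (suc p) = 0
completions zero    (suc f) p       = 0
completions (suc k) f       zero    = completionsBelow k f zero
completions (suc k) f       (suc p) = completions k f p + completionsBelow k f (suc p)
completionsBelow k zero    p = 0
completionsBelow k (suc f) p = completions k f p + completionsBelow k f (suc p)

completions-pendingOnly : ∀ p → completions p 0 p ≡ 1
completions-pendingOnly zero    = refl
completions-pendingOnly (suc p) = cong (_+ 0) (completions-pendingOnly p)

-- M C (f - 1), with the convention that it vanishes for f = 0
_C[_-1] : ℕ → ℕ → ℕ
M C[ zero  -1] = 0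
M C[ suc f -1] = M C f

C[-1]+C≡[1+]C : ∀ M f → M C[ f -1] + M C f ≡ suc M C f
C[-1]+C≡[1+]C M zero    = refl
C[-1]+C≡[1+]C M (suc f) = nCk+nC[k+1]≡[n+1]C[k+1] M f

[m+k]Cm≡[m+k]Ck : ∀ m k → (m + k) C m ≡ (m + k) C k
[m+k]Cm≡[m+k]Ck m k = trans (nCk≡nC[n∸k] (m≤m+n m k)) (cong ((m + k) C_) (m+n∸m≡n m k))

-- k and M are passed as equations so that the induction needs no casts.
completions-ballot : ∀ f p {k M} → k ≡ f + p → M ≡ f + f + p →
                     completions k f p + M C[ f -1] ≡ M C f
completions-ballot zero p refl refl = cong (_+ 0) (completions-pendingOnly p)
completions-ballot (suc g) zero {suc k} {suc M} k≡ M≡ = begin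
    completions (suc k) g 1 + suc M C g            ≡⟨ cong (_+_ (completions (suc k) g 1)) (C[-1]+C≡[1+]C M g) ⟨
    completions (suc k) g 1 + (M C[ g -1] + M C g) ≡⟨ +-assoc (completions (suc k) g 1) _ _ ⟨
    completions (suc k) g 1 + M C[ g -1] + M C g   ≡⟨ cong (_+ M C g) ih ⟩
    M C g + M C g                                  ≡⟨ cong (_+_ (M C g)) symmetric ⟨
    M C g + M C suc g                              ≡⟨ nCk+nC[k+1]≡[n+1]C[k+1] M g ⟩
    suc M C suc g                                  ∎
  where
  open ≡-Reasoning
  M≡1+g+g : M ≡ suc g + g
  M≡1+g+g = trans (suc-injective M≡) (trans (+-identityʳ _) (+-suc g g))
  ih : completions (suc k) g 1 + M C[ g -1] ≡ M C g
  ih = completions-ballot g 1 (trans (cong suc (trans (suc-injective k≡) (+-identityʳ g))) (+-comm 1 g))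
                            (trans M≡1+g+g (+-comm 1 (g + g)))
  symmetric : M C suc g ≡ M C g
  symmetric = subst (λ M → M C suc g ≡ M C g) (sym M≡1+g+g) ([m+k]Cm≡[m+k]Ck (suc g) g)
completions-ballot (suc g) (suc q) {suc k} {suc M} k≡ M≡ = begin
    (A + B) + suc M C g            ≡⟨ cong (_+_ (A + B)) (C[-1]+C≡[1+]C M g) ⟨
    (A + B) + (M C[ g -1] + M C g) ≡⟨ regroup A B (M C[ g -1]) (M C g) ⟩
    A + (B + M C[ g -1]) + M C g   ≡⟨ cong (λ z → A + z + M C g) ih-pop ⟩
    A + M C g + M C g              ≡⟨ cong (_+ M C g) ih-below ⟩
    M C suc g + M C g              ≡⟨ +-comm (M C suc g) (M C g) ⟩
    M C g + M C suc g              ≡⟨ nCk+nC[k+1]≡[n+1]C[k+1] M g ⟩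
    suc M C suc g                  ∎
  where
  open ≡-Reasoning
  A = completions k (suc g) q
  B = completions (suc k) g (suc (suc q))
  regroup : ∀ a b c d → (a + b) + (c + d) ≡ a + (b + c) + d
  regroup = solve-∀
  k≡′ : k ≡ g + suc q
  k≡′ = suc-injective k≡
  M≡′ : M ≡ g + suc g + suc q
  M≡′ = suc-injective M≡
  ih-below : A + M C g ≡ M C suc g
  ih-below = completions-ballot (suc g) q (trans k≡′ (+-suc g q))
               (trans M≡′ (+-suc (g + suc g) q))
  ih-pop : B + M C[ g -1] ≡ M C g
  ih-pop = completions-ballot g (suc (suc q)) (trans (cong suc k≡′) (sym (+-suc g (suc q))))
             (trans M≡′ (arith g q))
    where arith : ∀ g q → g + suc g + suc q ≡ g + g + suc (suc q)
          arith = solve-∀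

[1+k]*[1+m]C[1+k]≡[1+m]*mCk : ∀ m k → suc k * (suc m C suc k) ≡ suc m * (m C k)
[1+k]*[1+m]C[1+k]≡[1+m]*mCk zero zero = refl
[1+k]*[1+m]C[1+k]≡[1+m]*mCk zero (suc k)
  rewrite k>n⇒nCk≡0 {1} {suc (suc k)} (s≤s (s≤s z≤n)) | k>n⇒nCk≡0 {0} {suc k} (s≤s z≤n) = *-zeroʳ (suc (suc k))
[1+k]*[1+m]C[1+k]≡[1+m]*mCk (suc m) zero
  rewrite nC1≡n (suc (suc m)) = trans (+-identityʳ _) (sym (*-identityʳ _))
[1+k]*[1+m]C[1+k]≡[1+m]*mCk (suc m) (suc j) = begin
    suc (suc j) * (suc (suc m) C suc (suc j))  ≡⟨ cong (suc (suc j) *_) (nCk+nC[k+1]≡[n+1]C[k+1] (suc m) (suc j)) ⟨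
    suc (suc j) * (Y + Z)                       ≡⟨ distrib j Y Z ⟩
    suc j * Y + Y + suc (suc j) * Z             ≡⟨ cong₂ (λ a b → a + Y + b) ([1+k]*[1+m]C[1+k]≡[1+m]*mCk m j)
                                                                           ([1+k]*[1+m]C[1+k]≡[1+m]*mCk m (suc j)) ⟩
    suc m * (m C j) + Y + suc m * (m C suc j)   ≡⟨ factor (suc m) (m C j) Y (m C suc j) ⟩
    suc m * (m C j + m C suc j) + Y             ≡⟨ cong (λ z → suc m * z + Y) (nCk+nC[k+1]≡[n+1]C[k+1] m j) ⟩
    suc m * Y + Y                               ≡⟨ +-comm (suc m * Y) Y ⟩
    suc (suc m) * Y                             ∎
  where
  open ≡-Reasoning
  Y = suc m C suc j
  Z = suc m C suc (suc j)
  distrib : ∀ j y z → suc (suc j) * (y + z) ≡ suc j * y + y + suc (suc j) * z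
  distrib = solve-∀
  factor : ∀ a b y c → a * b + y + a * c ≡ a * (b + c) + y
  factor = solve-∀

-- The identity behind C(2a+2, a+1) - C(2a+2, a) = C(2a+2, a+1) / (a+2).
[1+a]*[2+2a]C[1+a]≡[2+a]*[2+2a]Ca : ∀ a →
  suc a * (suc (suc (a + a)) C suc a) ≡ suc (suc a) * (suc (suc (a + a)) C a)
[1+a]*[2+2a]C[1+a]≡[2+a]*[2+2a]Ca a = begin
    suc a * (suc (suc (a + a)) C suc a)           ≡⟨ [1+k]*[1+m]C[1+k]≡[1+m]*mCk (suc (a + a)) a ⟩
    suc (suc (a + a)) * (suc (a + a) C a)         ≡⟨ cong (suc (suc (a + a)) *_) ([m+k]Cm≡[m+k]Ck (suc a) a) ⟨
    suc (suc (a + a)) * (suc (a + a) C suc a)     ≡⟨ [1+k]*[1+m]C[1+k]≡[1+m]*mCk (suc (a + a)) (suc a) ⟨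
    suc (suc a) * (suc (suc (a + a)) C suc (suc a)) ≡⟨ cong (suc (suc a) *_) ([m+k]Cm≡[m+k]Ck (suc (suc a)) a) ⟩
    suc (suc a) * (suc (suc (a + a)) C a)         ∎
  where open ≡-Reasoning

completions-catalan : ∀ a → completions (suc a) (suc a) 0 ≡ catalan (suc a)
completions-catalan a = begin
    B                                          ≡⟨ m*n/n≡m B (suc (suc a)) ⟨
    (B * suc (suc a)) / suc (suc a)            ≡⟨ cong (_/ suc (suc a)) B*[2+a]≡K ⟩
    K / suc (suc a)                            ≡⟨ cong (λ M → (M C suc a) / suc (suc a)) 2+a+a≡2*[1+a] ⟩
    ((2 * suc a) C suc a) / suc (suc a)        ∎
  where
  open ≡-Reasoning
  M = suc (suc (a + a))
  K = M C suc a
  X = M C a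
  B = completions (suc a) (suc a) 0
  2+a+a≡2*[1+a] : M ≡ 2 * suc a
  2+a+a≡2*[1+a] = arith a
    where arith : ∀ a → suc (suc (a + a)) ≡ 2 * suc a
          arith = solve-∀
  B+X≡K : B + X ≡ K
  B+X≡K = completions-ballot (suc a) 0 (sym (+-identityʳ (suc a))) (cong suc (sym (trans (+-identityʳ _) (+-suc a a))))
  B*[2+a]≡K : B * suc (suc a) ≡ K
  B*[2+a]≡K = +-cancelʳ-≡ (suc (suc a) * X) _ _ (begin
    B * suc (suc a) + suc (suc a) * X    ≡⟨ cong (_+ suc (suc a) * X) (*-comm B (suc (suc a))) ⟩
    suc (suc a) * B + suc (suc a) * X    ≡⟨ *-distribˡ-+ (suc (suc a)) B X ⟨
    suc (suc a) * (B + X)                ≡⟨ cong (suc (suc a) *_) B+X≡K ⟩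
    suc (suc a) * K                      ≡⟨ cong (_+_ K) ([1+a]*[2+2a]C[1+a]≡[2+a]*[2+2a]Ca a) ⟩
    K + suc (suc a) * X                  ∎)

-- Row-by-row construction

-- A column below f is either f - 1 itself, or lies further down and f - 1 becomes pending.
fillings      : (k : ℕ) → ℕ → List ℕ → List (Vec ℕ k)
fillingsBelow : (k : ℕ) → ℕ → List ℕ → List (Vec ℕ (suc k))
fillings zero    zero    []      = [] ∷ []
fillings zero    zero    (_ ∷ _) = []
fillings zero    (suc f) P       = []
fillings (suc k) f       []      = fillingsBelow k f []
fillings (suc k) f       (g ∷ P) = List.map (g ∷_) (fillings k f P) ++ fillingsBelow k f (g ∷ P)
fillingsBelow k zero    P = []
fillingsBelow k (suc f) P = List.map (f ∷_) (fillings k f P) ++ fillingsBelow k f (f ∷ P)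

length-map-cons-++ : ∀ {k} v (L : List (Vec ℕ k)) R → length (List.map (v ∷_) L ++ R) ≡ length L + length R
length-map-cons-++ v L R =
  trans (List.length-++ (List.map (v ∷_) L)) (cong (_+ length R) (List.length-map (v ∷_) L))

length-fillings      : ∀ k f P → length (fillings k f P) ≡ completions k f (length P)
length-fillingsBelow : ∀ k f P → length (fillingsBelow k f P) ≡ completionsBelow k f (length P)
length-fillings zero    zero    []      = refl
length-fillings zero    zero    (_ ∷ _) = refl
length-fillings zero    (suc f) P       = refl
length-fillings (suc k) f       []      = length-fillingsBelow k f []
length-fillings (suc k) f       (g ∷ P) = trans (length-map-cons-++ g (fillings k f P) _)
  (cong₂ _+_ (length-fillings k f P) (length-fillingsBelow k f (g ∷ P)))
length-fillingsBelow k zero    P = refl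
length-fillingsBelow k (suc f) P = trans (length-map-cons-++ f (fillings k f P) _)
  (cong₂ _+_ (length-fillings k f P) (length-fillingsBelow k f (f ∷ P)))

∈-fillingsBelow⇒head< : ∀ {k f P s} → s ∈ fillingsBelow k f P → head s < f
∈-fillingsBelow⇒head< {k} {suc f} {P} s∈ with ∈-++⁻ (List.map (f ∷_) (fillings k f P)) s∈
... | inj₁ s∈map with ∈-map⁻ (f ∷_) s∈map
...   | _ , _ , refl = ≤-refl
∈-fillingsBelow⇒head< {k} {suc f} {P} s∈ | inj₂ s∈below = m<n⇒m<1+n (∈-fillingsBelow⇒head< s∈below)

map-cons-++-unique : ∀ {k v} {L : List (Vec ℕ k)} {R} → Unique L → Unique R →
                     (∀ {s} → s ∈ R → head s ≢ v) → Unique (List.map (v ∷_) L ++ R)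
map-cons-++-unique {v = v} {L} {R} uniqueL uniqueR v∉R =
  Unique.++⁺ (Unique.map⁺ ∷-injectiveʳ uniqueL) uniqueR disjoint
  where
  disjoint : ∀ {s} → ¬ (s ∈ List.map (v ∷_) L × s ∈ R)
  disjoint (s∈L , s∈R) with ∈-map⁻ (v ∷_) s∈L
  ... | _ , _ , refl = v∉R s∈R refl

fillings-unique      : ∀ k f P → All (f ≤_) P → Unique (fillings k f P)
fillingsBelow-unique : ∀ k f P → All (f ≤_) P → Unique (fillingsBelow k f P)
fillings-unique zero    zero    []      _ = All.[] AllPairs.∷ AllPairs.[]
fillings-unique zero    zero    (_ ∷ _) _ = AllPairs.[]
fillings-unique zero    (suc f) P       _ = AllPairs.[]
fillings-unique (suc k) f       []      _ = fillingsBelow-unique k f [] All.[]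
fillings-unique (suc k) f       (g ∷ P) f≤gP@(f≤g All.∷ f≤P) =
  map-cons-++-unique (fillings-unique k f P f≤P) (fillingsBelow-unique k f (g ∷ P) f≤gP)
    (λ s∈ → <⇒≢ (<-≤-trans (∈-fillingsBelow⇒head< s∈) f≤g))
fillingsBelow-unique k zero    P _    = AllPairs.[]
fillingsBelow-unique k (suc f) P f<P =
  map-cons-++-unique (fillings-unique k f P f≤P) (fillingsBelow-unique k f (f ∷ P) (≤-refl All.∷ f≤P))
    (λ s∈ → <⇒≢ (∈-fillingsBelow⇒head< s∈))
  where
  f≤P : All (f ≤_) P
  f≤P = All.map <⇒≤ f<P

iverson : Bool → ℕ
iverson true  = 1
iverson false = 0

iverson≤1 : ∀ b → iverson b ≤ 1
iverson≤1 true  = s≤s z≤n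
iverson≤1 false = z≤n

iverson≡1⇒T : ∀ {b} → iverson b ≡ 1 → T b
iverson≡1⇒T {true} _ = tt

2+m<n⇒m<n : ∀ {m n} → suc (suc m) < n → m < n
2+m<n⇒m<n 2+m<n = <-trans (n<1+n _) (<-trans (n<1+n _) 2+m<n)

2+m<n⇒1+m<n : ∀ {m n} → suc (suc m) < n → suc m < n
2+m<n⇒1+m<n = <-trans (n<1+n _)

ColumnSums : Set
ColumnSums = ℕ → ℕ

addRow : ColumnSums → ℕ → ColumnSums
addRow S v x = S x + iverson (x ≡ᵇ v)

noRows : ColumnSums
noRows _ = 0

afterRows : ∀ {k} → ColumnSums → Vec ℕ k → ℕ → ColumnSums
afterRows S s       zero    = S
afterRows S []      (suc m) = S
afterRows S (v ∷ s) (suc m) = afterRows (addRow S v) s m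

afterRows-suc : ∀ {k} S (s : Vec ℕ k) i x →
                afterRows S s (suc (toℕ i)) x ≡ addRow (afterRows S s (toℕ i)) (lookup s i) x
afterRows-suc S (v ∷ s) fzero    x = refl
afterRows-suc S (v ∷ s) (fsuc i) x = afterRows-suc (addRow S v) s i x

afterRows-shift : ∀ {k} S (s : Vec ℕ k) m x → afterRows S s m x ≡ S x + afterRows noRows s m x
afterRows-shift S s       zero    x = sym (+-identityʳ _)
afterRows-shift S []      (suc m) x = sym (+-identityʳ _)
afterRows-shift S (v ∷ s) (suc m) x = begin
  afterRows (addRow S v) s m x                    ≡⟨ afterRows-shift (addRow S v) s m x ⟩
  S x + iverson (x ≡ᵇ v) + afterRows noRows s m x  ≡⟨ +-assoc (S x) _ _ ⟩
  S x + (iverson (x ≡ᵇ v) + afterRows noRows s m x) ≡⟨ cong (_+_ (S x)) (afterRows-shift (addRow noRows v) s m x) ⟨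
  S x + afterRows (addRow noRows v) s m x           ∎
  where open ≡-Reasoning

afterRows-≥ : ∀ {k} S (s : Vec ℕ k) m x → S x ≤ afterRows S s m x
afterRows-≥ S s       zero    x = ≤-refl
afterRows-≥ S []      (suc m) x = ≤-refl
afterRows-≥ S (v ∷ s) (suc m) x = ≤-trans (m≤m+n (S x) _) (afterRows-≥ (addRow S v) s m x)

afterRows-mono : ∀ {k} S (s : Vec ℕ k) {m m′} x → m ≤ m′ → afterRows S s m x ≤ afterRows S s m′ x
afterRows-mono S s       {m′ = m′} x z≤n = afterRows-≥ S s m′ x
afterRows-mono S []      x (s≤s _)   = ≤-refl
afterRows-mono S (v ∷ s) x (s≤s m≤m′) = afterRows-mono (addRow S v) s x m≤m′

module Validity (n : ℕ) where

  -- With S the column sums of the rows above row i and v the column of row i, this is the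
  -- magog inequality  Col(i-1, j) ≤ Row(i, j) + Col(i, j+1).
  Admissible : ColumnSums → ℕ → Set
  Admissible S v = ∀ j → suc (suc j) < n → S j ≤ iverson (v ≤ᵇ j) + addRow S v (suc j)

  Step : ColumnSums → ℕ → Set
  Step S v = v < n × S v ≡ 0 × Admissible S v

  Full : ColumnSums → Set
  Full S = ∀ x → x < n → S x ≡ 1

  Valid : ∀ {k} → ColumnSums → Vec ℕ k → Set
  Valid S []      = Full S
  Valid S (v ∷ s) = Step S v × Valid (addRow S v) s

  infix 4 _≈_
  _≈_ : ColumnSums → ColumnSums → Set
  S ≈ T = ∀ x → x < n → S x ≡ T x

  addRow-resp-≈ : ∀ {S T} v → S ≈ T → addRow S v ≈ addRow T v
  addRow-resp-≈ v S≈T x x<n = cong (_+ iverson (x ≡ᵇ v)) (S≈T x x<n)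

  Valid-resp-≈ : ∀ {k S T} (s : Vec ℕ k) → S ≈ T → Valid S s → Valid T s
  Valid-resp-≈ []      S≈T full x x<n = trans (sym (S≈T x x<n)) (full x x<n)
  Valid-resp-≈ {T = T} (v ∷ s) S≈T ((v<n , Sv≡0 , adm) , valid) =
    (v<n , trans (sym (S≈T v v<n)) Sv≡0 , admT) , Valid-resp-≈ s (addRow-resp-≈ v S≈T) valid
    where
    admT : Admissible T v
    admT j j+2<n rewrite sym (S≈T j (2+m<n⇒m<n j+2<n)) | sym (S≈T (suc j) (2+m<n⇒1+m<n j+2<n)) = adm j j+2<n

  Valid-resp-≗ : ∀ {k S T} (s : Vec ℕ k) → S ≗ T → Valid S s → Valid T s
  Valid-resp-≗ s S≗T = Valid-resp-≈ s (λ x _ → S≗T x)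

  Valid⇒Step : ∀ {k S} (s : Vec ℕ k) → Valid S s → ∀ i → Step (afterRows S s (toℕ i)) (lookup s i)
  Valid⇒Step (v ∷ s) (step , _)     fzero    = step
  Valid⇒Step (v ∷ s) (_    , valid) (fsuc i) = Valid⇒Step s valid i

  Valid⇒Full : ∀ {k S} (s : Vec ℕ k) → Valid S s → Full (afterRows S s k)
  Valid⇒Full []      full        = full
  Valid⇒Full (v ∷ s) (_ , valid) = Valid⇒Full s valid

  Step⇒Valid : ∀ {k S} (s : Vec ℕ k) → (∀ i → Step (afterRows S s (toℕ i)) (lookup s i)) →
               Full (afterRows S s k) → Valid S s
  Step⇒Valid []      _    full = full
  Step⇒Valid (v ∷ s) step full = step fzero , Step⇒Valid s (λ i → step (fsuc i)) full

module Stack (n : ℕ) where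
  open Validity n

  Increasing : ℕ → List ℕ → Set
  Increasing b []      = ⊤
  Increasing b (x ∷ P) = b < x × x < n × Increasing x P

  Increasing-weaken : ∀ {a b P} → a ≤ b → Increasing b P → Increasing a P
  Increasing-weaken {P = []}    a≤b _                  = tt
  Increasing-weaken {P = x ∷ P} a≤b (b<x , x<n , incP) = ≤-<-trans a≤b b<x , x<n , incP

  Increasing⇒∉ : ∀ {b P x} → Increasing b P → x ≤ b → x ∉ P
  Increasing⇒∉ (b<x , _ , _)    x≤b (here refl)  = <⇒≱ b<x x≤b
  Increasing⇒∉ (b<y , _ , incP) x≤b (there x∈P) = Increasing⇒∉ incP (<⇒≤ (≤-<-trans x≤b b<y)) x∈P

  Increasing⇒∈⇒> : ∀ {b P x} → Increasing b P → x ∈ P → b < x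
  Increasing⇒∈⇒> (b<x , _ , _)    (here refl)  = b<x
  Increasing⇒∈⇒> (b<y , _ , incP) (there x∈P) = <-trans b<y (Increasing⇒∈⇒> incP x∈P)

  occupied : ℕ → List ℕ → ColumnSums
  occupied f P x = iverson ((f ≤ᵇ x) ∧ not (does (x ∈? P)))

  occupied-below : ∀ {f P x} → x < f → occupied f P x ≡ 0
  occupied-below {f} {P} {x} x<f rewrite dec-false (f ≤? x) (<⇒≱ x<f) = refl

  occupied-pending : ∀ {f P x} → x ∈ P → occupied f P x ≡ 0
  occupied-pending {f} {P} {x} x∈P rewrite dec-true (x ∈? P) x∈P | ∧-zeroʳ (f ≤ᵇ x) = refl

  occupied-free : ∀ {f P x} → f ≤ x → x ∉ P → occupied f P x ≡ 1
  occupied-free {f} {P} {x} f≤x x∉P rewrite dec-true (f ≤? x) f≤x | dec-false (x ∈? P) x∉P = refl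

  occupied≡0 : ∀ {f P x} → occupied f P x ≡ 0 → x < f ⊎ x ∈ P
  occupied≡0 {f} {P} {x} Sx≡0 with f ≤? x
  ... | no f≰x  = inj₁ (≰⇒> f≰x)
  ... | yes f≤x = inj₂ (decidable-stable (x ∈? P) λ x∉P → 1≢0 (trans (sym (occupied-free f≤x x∉P)) Sx≡0))
    where 1≢0 : 1 ≢ 0
          1≢0 ()

  descend : ∀ {f P} → Increasing f P → addRow (occupied (suc f) P) f ≗ occupied f P
  descend {f} {P} incP x with <-cmp x f
  ... | tri< x<f _ _
    rewrite occupied-below {suc f} {P} (m<n⇒m<1+n x<f) | dec-false (x ≟ f) (<⇒≢ x<f) | occupied-below {f} {P} x<f = refl
  ... | tri≈ _ refl _
    rewrite occupied-below {suc x} {P} (n<1+n x) | dec-true (x ≟ x) refl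
          | occupied-free {x} {P} ≤-refl (Increasing⇒∉ incP ≤-refl) = refl
  ... | tri> _ x≢f f<x
    rewrite dec-true (suc f ≤? x) f<x | dec-true (f ≤? x) (<⇒≤ f<x) | dec-false (x ≟ f) x≢f = +-identityʳ _

  push : ∀ {f P} → occupied f (f ∷ P) ≗ occupied (suc f) P
  push {f} {P} x with <-cmp x f
  ... | tri< x<f _ _ rewrite occupied-below {suc f} {P} (m<n⇒m<1+n x<f) | occupied-below {f} {f ∷ P} x<f = refl
  ... | tri≈ _ refl _ rewrite occupied-below {suc x} {P} (n<1+n x) = occupied-pending {x} {x ∷ P} (here refl)
  ... | tri> _ x≢f f<x rewrite dec-true (suc f ≤? x) f<x | dec-true (f ≤? x) (<⇒≤ f<x) | dec-false (x ≟ f) x≢f = refl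

  pop : ∀ {f g P} → Increasing f (g ∷ P) → addRow (occupied f (g ∷ P)) g ≗ occupied f P
  pop {f} {g} {P} (f<g , _ , incP) x with x ≟ g
  ... | yes refl = begin
    occupied f (x ∷ P) x + iverson (x ≡ᵇ x) ≡⟨ cong₂ _+_ (occupied-pending {f} {x ∷ P} (here refl))
                                                          (cong iverson (dec-true (x ≟ x) refl)) ⟩
    1                                        ≡⟨ occupied-free (<⇒≤ f<g) (Increasing⇒∉ incP ≤-refl) ⟨
    occupied f P x                           ∎
    where open ≡-Reasoning
  ... | no x≢g rewrite dec-false (x ≟ g) x≢g = +-identityʳ _

  admissible-below : ∀ {f P v} → v < f → Admissible (occupied f P) v
  admissible-below {f} {P} {v} v<f j _ with f ≤? j
  ... | no f≰j rewrite occupied-below {f} {P} (≰⇒> f≰j) = z≤n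
  ... | yes f≤j rewrite dec-true (v ≤? j) (<⇒≤ (<-≤-trans v<f f≤j)) = ≤-trans (iverson≤1 _) (m≤m+n 1 _)

  admissible-pop : ∀ {f g P} → Increasing f (g ∷ P) → Admissible (occupied f (g ∷ P)) g
  admissible-pop {f} {g} {P} (f<g , g<n , incP) j _ with f ≤? j
  ... | no f≰j rewrite occupied-below {f} {g ∷ P} (≰⇒> f≰j) = z≤n
  ... | yes f≤j with g ≤? j
  ...   | yes g≤j rewrite dec-true (g ≤? j) g≤j = ≤-trans (iverson≤1 _) (m≤m+n 1 _)
  ...   | no g≰j = ≤-trans (iverson≤1 _) (≤-trans 1≤next (m≤n+m _ (iverson (g ≤ᵇ j))))
    where
    1≤next : 1 ≤ addRow (occupied f (g ∷ P)) g (suc j)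
    1≤next with suc j ≟ g
    ... | yes refl rewrite dec-true (suc j ≟ suc j) refl = m≤n+m 1 _
    ... | no 1+j≢g
      rewrite occupied-free {f} {g ∷ P} {suc j} (m≤n⇒m≤1+n f≤j)
                (Increasing⇒∉ (≤∧≢⇒< (≰⇒> g≰j) 1+j≢g , g<n , incP) ≤-refl) = m≤m+n 1 _

  -- Skipping the first pending column g: column g - 1 is used, g stays free, and the new 1 lies right of both.
  skip-inadmissible : ∀ {f g P v} → Increasing f (g ∷ P) → v ∈ P → v < n →
                      ¬ Admissible (occupied f (g ∷ P)) v
  skip-inadmissible {g = zero} (() , _)
  skip-inadmissible {f} {suc j} {P} {v} (f<g , g<n , incP) v∈P v<n adm =
    1+n≰n (subst₂ _≤_ occupied-j≡1 rhs≡0 (adm j (≤-<-trans g<v v<n)))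
    where
    g<v : suc j < v
    g<v = Increasing⇒∈⇒> incP v∈P
    occupied-j≡1 : occupied f (suc j ∷ P) j ≡ 1
    occupied-j≡1 = occupied-free (s≤s⁻¹ f<g) (Increasing⇒∉ (n<1+n j , g<n , incP) ≤-refl)
    rhs≡0 : iverson (v ≤ᵇ j) + addRow (occupied f (suc j ∷ P)) v (suc j) ≡ 0
    rhs≡0 = cong₂ _+_ (cong iverson (dec-false (v ≤? j) (<⇒≱ (<-trans (n<1+n j) g<v))))
                      (cong₂ _+_ (occupied-pending {f} {suc j ∷ P} (here refl))
                                 (cong iverson (dec-false (suc j ≟ v) (<⇒≢ g<v))))

  admissible-choices : ∀ {f P v} → Increasing f P → occupied f P v ≡ 0 → v < n →
                       Admissible (occupied f P) v → v < f ⊎ ∃ λ P′ → P ≡ v ∷ P′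
  admissible-choices {P = P} incP Sv≡0 v<n adm with occupied≡0 {P = P} Sv≡0
  ... | inj₁ v<f          = inj₁ v<f
  ... | inj₂ (here refl)  = inj₂ (_ , refl)
  ... | inj₂ (there v∈P′) = contradiction adm (skip-inadmissible incP v∈P′ v<n)


  fillings-sound      : ∀ k f P {s} → f ≤ n → Increasing f P → s ∈ fillings k f P → Valid (occupied f P) s
  fillingsBelow-sound : ∀ k f P {s} → suc f ≤ n → Increasing f P → s ∈ fillingsBelow k (suc f) P →
                        Valid (occupied (suc f) P) s
  fillings-sound zero    zero    []      _ _ (here refl) _ _ = refl
  fillings-sound (suc k) (suc f) []      f<n _ s∈ = fillingsBelow-sound k f [] f<n tt s∈
  fillings-sound (suc k) f       (g ∷ P) f≤n incP s∈ with ∈-++⁻ (List.map (g ∷_) (fillings k f P)) s∈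
  fillings-sound (suc k) f (g ∷ P) f≤n incP@(f<g , g<n , incP′) s∈ | inj₁ s∈map with ∈-map⁻ (g ∷_) s∈map
  ... | s , s∈′ , refl =
    (g<n , occupied-pending {f} {g ∷ P} (here refl) , admissible-pop incP) ,
    Valid-resp-≗ s (λ x → sym (pop incP x)) (fillings-sound k f P f≤n (Increasing-weaken (<⇒≤ f<g) incP′) s∈′)
  fillings-sound (suc k) (suc f) (g ∷ P) f<n incP s∈ | inj₂ s∈below =
    fillingsBelow-sound k f (g ∷ P) f<n (Increasing-weaken (n≤1+n f) incP) s∈below
  fillingsBelow-sound k f P f<n incP s∈ with ∈-++⁻ (List.map (f ∷_) (fillings k f P)) s∈
  ... | inj₁ s∈map with ∈-map⁻ (f ∷_) s∈map
  ...   | s , s∈′ , refl =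
    (f<n , occupied-below {suc f} {P} (n<1+n f) , admissible-below {suc f} {P} (n<1+n f)) ,
    Valid-resp-≗ s (λ x → sym (descend incP x)) (fillings-sound k f P (<⇒≤ f<n) incP s∈′)
  fillingsBelow-sound k (suc f) P f<n incP s∈ | inj₂ s∈below =
    Valid-resp-≗ _ (push {suc f} {P}) (fillingsBelow-sound k f (suc f ∷ P) (<⇒≤ f<n) (n<1+n f , f<n , incP) s∈below)

  fillings-complete      : ∀ k f P (s : Vec ℕ k) → f ≤ n → Increasing f P → Valid (occupied f P) s →
                           s ∈ fillings k f P
  fillingsBelow-complete : ∀ k f P v (s : Vec ℕ k) → suc f ≤ n → Increasing f P → v ≤ f →
                           Valid (occupied (suc f) P) (v ∷ s) → v ∷ s ∈ fillingsBelow k (suc f) P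
  fillings-complete zero zero [] [] _ _ _ = here refl
  fillings-complete zero zero (g ∷ P) [] _ (_ , g<n , _) full =
    contradiction (trans (sym (full g g<n)) (occupied-pending {0} {g ∷ P} (here refl))) λ ()
  fillings-complete zero (suc f) P [] f<n _ full =
    contradiction (trans (sym (full 0 (≤-<-trans z≤n f<n))) (occupied-below {suc f} {P} z<s)) λ ()
  fillings-complete (suc k) f P (v ∷ s) f≤n incP valid@((v<n , Sv≡0 , adm) , _)
    with admissible-choices incP Sv≡0 v<n adm
  fillings-complete (suc k) (suc f) [] (v ∷ s) f<n _ valid | inj₁ v<f =
    fillingsBelow-complete k f [] v s f<n tt (s≤s⁻¹ v<f) valid
  fillings-complete (suc k) (suc f) (g ∷ P) (v ∷ s) f<n incP valid | inj₁ v<f =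
    ∈-++⁺ʳ (List.map (g ∷_) (fillings k (suc f) P))
      (fillingsBelow-complete k f (g ∷ P) v s f<n (Increasing-weaken (n≤1+n f) incP) (s≤s⁻¹ v<f) valid)
  fillings-complete (suc k) f .(v ∷ P) (v ∷ s) f≤n incP@(f<v , _ , incP′) (_ , valid) | inj₂ (P , refl) =
    ∈-++⁺ˡ (∈-map⁺ (v ∷_) (fillings-complete k f P s f≤n (Increasing-weaken (<⇒≤ f<v) incP′)
      (Valid-resp-≗ s (pop incP) valid)))
  fillingsBelow-complete k f P v s f<n incP v≤f (_ , valid) with v ≟ f
  ... | yes refl =
    ∈-++⁺ˡ (∈-map⁺ (v ∷_) (fillings-complete k v P s (<⇒≤ f<n) incP (Valid-resp-≗ s (descend incP) valid)))
  ... | no v≢f with ≤∧≢⇒< v≤f v≢f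
  fillingsBelow-complete k (suc f) P v s f<n incP v≤f valid | no _ | v<f =
    ∈-++⁺ʳ (List.map (suc f ∷_) (fillings k (suc f) P))
      (fillingsBelow-complete k f (suc f ∷ P) v s (<⇒≤ f<n) (n<1+n f , f<n , incP) (s≤s⁻¹ v<f)
        (Valid-resp-≗ (v ∷ s) (λ x → sym (push {suc f} {P} x)) valid))

-- Matrices with a single 1 in each row

unitRow : ∀ {m} → ℕ → Vec ℤ m
unitRow v = tabulate (λ j → + iverson (toℕ j ≡ᵇ v))

rows : ∀ {m k} → Vec ℕ k → Vec (Vec ℤ m) k
rows = Vec.map unitRow

lookup-rows : ∀ {m k} (s : Vec ℕ k) i (j : Fin m) → lookup (lookup (rows s) i) j ≡ + iverson (toℕ j ≡ᵇ lookup s i)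
lookup-rows s i j = trans (cong (λ r → lookup r j) (lookup-map i unitRow s)) (lookup∘tabulate _ j)

prefix-cong : ∀ {m} {f g : Fin m → ℤ} → (∀ k → f k ≡ g k) → ∀ i → prefix f i ≡ prefix g i
prefix-cong f≗g fzero    = f≗g fzero
prefix-cong f≗g (fsuc i) = cong₂ ℤ._+_ (f≗g fzero) (prefix-cong (λ k → f≗g (fsuc k)) i)

total-cong : ∀ {m} {f g : Fin m → ℤ} → (∀ k → f k ≡ g k) → total f ≡ total g
total-cong {zero}  f≗g = refl
total-cong {suc m} f≗g = cong₂ ℤ._+_ (f≗g fzero) (total-cong (λ k → f≗g (fsuc k)))

prefix-zeros : ∀ {m} (i : Fin m) → prefix (λ _ → 0ℤ) i ≡ 0ℤ
prefix-zeros fzero    = refl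
prefix-zeros (fsuc i) = cong (ℤ._+_ 0ℤ) (prefix-zeros i)

total-zeros : ∀ {m} → total {m} (λ _ → 0ℤ) ≡ 0ℤ
total-zeros {zero}  = refl
total-zeros {suc m} = cong (ℤ._+_ 0ℤ) (total-zeros {m})

prefix-unitRow : ∀ {m} v (j : Fin m) → prefix (λ j′ → + iverson (toℕ j′ ≡ᵇ v)) j ≡ + iverson (v ≤ᵇ toℕ j)
prefix-unitRow zero          fzero    = refl
prefix-unitRow (suc v)       fzero    = refl
prefix-unitRow zero          (fsuc j) = cong (ℤ._+_ 1ℤ) (prefix-zeros j)
prefix-unitRow (suc zero)    (fsuc j) = cong (ℤ._+_ 0ℤ) (prefix-unitRow zero j)
prefix-unitRow (suc (suc v)) (fsuc j) = cong (ℤ._+_ 0ℤ) (prefix-unitRow (suc v) j)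

total-unitRow : ∀ {m} v → total {m} (λ j → + iverson (toℕ j ≡ᵇ v)) ≡ + iverson (suc v ≤ᵇ m)
total-unitRow {zero}  v       = refl
total-unitRow {suc m} zero    = cong (ℤ._+_ 1ℤ) (total-zeros {m})
total-unitRow {suc m} (suc v) = cong (ℤ._+_ 0ℤ) (total-unitRow {m} v)

prefix-column : ∀ {k} (s : Vec ℕ k) i x →
                prefix (λ i′ → + iverson (x ≡ᵇ lookup s i′)) i ≡ + afterRows noRows s (suc (toℕ i)) x
prefix-column (v ∷ s) fzero    x = refl
prefix-column (v ∷ s) (fsuc i) x
  rewrite prefix-column s i x | afterRows-shift (addRow noRows v) s (suc (toℕ i)) x = refl

total-column : ∀ {k} (s : Vec ℕ k) x → total (λ i → + iverson (x ≡ᵇ lookup s i)) ≡ + afterRows noRows s k x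
total-column []              x = refl
total-column {suc k} (v ∷ s) x rewrite total-column s x | afterRows-shift (addRow noRows v) s k x = refl

Is01 : ℤ → Set
Is01 z = z ≡ 0ℤ ⊎ z ≡ 1ℤ

total-01 : ∀ {m} (r : Vec ℤ m) → (∀ j → Is01 (lookup r j)) → ∃ λ t → total (lookup r) ≡ + t
total-01 []      _   = 0 , refl
total-01 (a ∷ r) r01 with r01 fzero | total-01 r (λ j → r01 (fsuc j))
... | inj₁ refl | t , r≡t = t     , cong (ℤ._+_ 0ℤ) r≡t
... | inj₂ refl | t , r≡t = suc t , cong (ℤ._+_ 1ℤ) r≡t

total-01≡0 : ∀ {m} (r : Vec ℤ m) → (∀ j → Is01 (lookup r j)) → total (lookup r) ≡ 0ℤ → r ≡ tabulate (λ _ → 0ℤ)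
total-01≡0 []      _   _      = refl
total-01≡0 (a ∷ r) r01 total≡0 with r01 fzero | total-01 r (λ j → r01 (fsuc j))
... | inj₁ refl | _ = cong (0ℤ ∷_) (total-01≡0 r (λ j → r01 (fsuc j)) (trans (sym (ℤ.+-identityˡ _)) total≡0))
... | inj₂ refl | t , r≡t = contradiction (trans (sym (cong (ℤ._+_ 1ℤ) r≡t)) total≡0) λ ()

total-01≡1 : ∀ {m} (r : Vec ℤ m) → (∀ j → Is01 (lookup r j)) → total (lookup r) ≡ 1ℤ → ∃ λ v → r ≡ unitRow v
total-01≡1 (a ∷ r) r01 total≡1 with r01 fzero | total-01 r (λ j → r01 (fsuc j))
... | inj₁ refl | _ with total-01≡1 r (λ j → r01 (fsuc j)) (trans (sym (ℤ.+-identityˡ _)) total≡1)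
...   | v , r≡v = suc v , cong (0ℤ ∷_) r≡v
total-01≡1 (a ∷ r) r01 total≡1 | inj₂ refl | t , r≡t =
  zero , cong (1ℤ ∷_) (total-01≡0 r (λ j → r01 (fsuc j)) (rest≡0 t r≡t total≡1))
  where
  rest≡0 : ∀ {x} t → x ≡ + t → 1ℤ ℤ.+ x ≡ 1ℤ → x ≡ 0ℤ
  rest≡0 zero    refl _ = refl
  rest≡0 (suc t) refl ()

01-matrix⇒rows : ∀ {m k} (A : Vec (Vec ℤ m) k) → (∀ i j → Is01 (lookup (lookup A i) j)) →
                 (∀ i → total (lookup (lookup A i)) ≡ 1ℤ) → ∃ λ s → A ≡ rows s
01-matrix⇒rows []      _   _        = [] , refl
01-matrix⇒rows (r ∷ A) A01 rowSum≡1 with total-01≡1 r (A01 fzero) (rowSum≡1 fzero)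
                                       | 01-matrix⇒rows A (λ i → A01 (fsuc i)) (λ i → rowSum≡1 (fsuc i))
... | v , r≡v | s , A≡s = v ∷ s , cong₂ _∷_ r≡v A≡s

unitRow-injective : ∀ {m v w} → v < m → unitRow {m} v ≡ unitRow w → v ≡ w
unitRow-injective {m} {v} {w} v<m v≡w with v ≟ w
... | yes v≡w = v≡w
... | no  v≢w = contradiction (trans (sym (at-v v)) (trans (cong (λ r → lookup r (fromℕ< v<m)) v≡w) (at-v w))) differ
  where
  differ : + iverson (v ≡ᵇ v) ≢ + iverson (v ≡ᵇ w)
  differ rewrite dec-true (v ≟ v) refl | dec-false (v ≟ w) v≢w = λ ()
  at-v : ∀ u → lookup (unitRow {m} u) (fromℕ< v<m) ≡ + iverson (v ≡ᵇ u)
  at-v u = trans (lookup∘tabulate _ (fromℕ< v<m)) (cong (λ z → + iverson (z ≡ᵇ u)) (toℕ-fromℕ< v<m))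

rows-injective : ∀ {m k} (s t : Vec ℕ k) → (∀ i → lookup s i < m) → rows {m} s ≡ rows t → s ≡ t
rows-injective []      []      _   _    = refl
rows-injective (v ∷ s) (w ∷ t) s<m s≡t =
  cong₂ _∷_ (unitRow-injective (s<m fzero) (∷-injectiveˡ s≡t))
            (rows-injective s t (λ i → s<m (fsuc i)) (∷-injectiveʳ s≡t))

module Magog (n : ℕ) where
  open Validity n

  Row-rows : ∀ (s : Vec ℕ n) i j → Row (rows s) i j ≡ + iverson (lookup s i ≤ᵇ toℕ j)
  Row-rows s i j = trans (prefix-cong (lookup-rows s i) j) (prefix-unitRow (lookup s i) j)

  Col-rows : ∀ (s : Vec ℕ n) i j → Col (rows s) i j ≡ + afterRows noRows s (suc (toℕ i)) (toℕ j)
  Col-rows s i j = trans (prefix-cong (λ i′ → lookup-rows s i′ j) i) (prefix-column s i (toℕ j))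

  rowSum-rows : ∀ (s : Vec ℕ n) i → total (λ j → entry (rows s) i j) ≡ + iverson (suc (lookup s i) ≤ᵇ n)
  rowSum-rows s i = trans (total-cong {n} (lookup-rows s i)) (total-unitRow {n} (lookup s i))

  colSum-rows : ∀ (s : Vec ℕ n) j → total (λ i → entry (rows s) i j) ≡ + afterRows noRows s n (toℕ j)
  colSum-rows s j = trans (total-cong (λ i → lookup-rows s i j)) (total-column s (toℕ j))

  magogIneq⇔Admissible : ∀ (s : Vec ℕ n) {i i′ j₀ j₁ : Fin n} {j} →
    toℕ i′ ≡ suc (toℕ i) → toℕ j₀ ≡ j → toℕ j₁ ≡ suc j →
    0ℤ ℤ.≤ (Row (rows s) i′ j₀ ℤ.+ Col (rows s) i′ j₁) ℤ.- Col (rows s) i j₀ ⇔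
    afterRows noRows s (toℕ i′) j ≤ iverson (lookup s i′ ≤ᵇ j) + addRow (afterRows noRows s (toℕ i′)) (lookup s i′) (suc j)
  magogIneq⇔Admissible s {i} {i′} {j₀} {j₁} i′≡ j₀≡ j₁≡
    rewrite Row-rows s i′ j₀ | Col-rows s i′ j₁ | Col-rows s i j₀ | afterRows-suc noRows s i′ (toℕ j₁)
          | j₀≡ | j₁≡ | sym i′≡ =
    mk⇔ (λ 0≤ → ℤ.drop‿+≤+ (ℤ.0≤i-j⇒j≤i 0≤)) (λ ≤+ → ℤ.i≤j⇒0≤j-i (ℤ.+≤+ ≤+))

  Valid⇒magog : ∀ (s : Vec ℕ n) → Valid noRows s → IsMagog (rows s) × NoMinusOne (rows s)
  Valid⇒magog s valid = magog , noMinusOne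
    where
    step = Valid⇒Step s valid
    full = Valid⇒Full s valid
    noMinusOne : NoMinusOne (rows s)
    noMinusOne i j entry≡-1 with trans (sym (lookup-rows s i j)) entry≡-1
    ... | ()
    magog : IsMagog (rows s)
    magog = record
      { entries   = λ i j → entry-01 (lookup-rows s i j)
      ; rowSum    = λ i → trans (rowSum-rows s i)
                              (cong (λ b → + iverson b) (dec-true (suc (lookup s i) ≤? n) (proj₁ (step i))))
      ; colSum    = λ j → trans (colSum-rows s j) (cong +_ (full (toℕ j) (toℕ<n j)))
      ; colPrefix = λ i j → subst (λ c → 0ℤ ℤ.≤ c × c ℤ.≤ 1ℤ) (sym (Col-rows s i j))
                      (ℤ.+≤+ z≤n , ℤ.+≤+ (≤-trans (afterRows-mono noRows s (toℕ j) (toℕ<n i))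
                                                    (≤-reflexive (full (toℕ j) (toℕ<n j)))))
      ; rowPrefix = λ i j → subst (0ℤ ℤ.≤_) (sym (Row-rows s i j)) (ℤ.+≤+ z≤n)
      ; magogIneq = λ i j i′ j′ i′≡ j′≡ _ j′<n-1 →
          Equivalence.from (magogIneq⇔Admissible s i′≡ refl j′≡)
            (proj₂ (proj₂ (step i′)) (toℕ j) (subst (λ z → suc z < n) j′≡ j′<n-1))
      }
      where
      entry-01 : ∀ {a b} → a ≡ + iverson b → a ≡ 0ℤ ⊎ (a ≡ 1ℤ ⊎ a ≡ -1ℤ)
      entry-01 {b = true}  refl = inj₂ (inj₁ refl)
      entry-01 {b = false} refl = inj₁ refl

  module _ (s : Vec ℕ n) (magog : IsMagog (rows s)) where
    open IsMagog magog

    magog⇒Full : Full (afterRows noRows s n)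
    magog⇒Full x x<n = subst (λ z → afterRows noRows s n z ≡ 1) (toℕ-fromℕ< x<n)
      (ℤ.+-injective (trans (sym (colSum-rows s (fromℕ< x<n))) (colSum (fromℕ< x<n))))

    magog⇒column<n : ∀ i → lookup s i < n
    magog⇒column<n i = ≤ᵇ⇒≤ (suc (lookup s i)) n
      (iverson≡1⇒T (ℤ.+-injective (trans (sym (rowSum-rows s i)) (rowSum i))))

    magog⇒columnFree : ∀ i → afterRows noRows s (toℕ i) (lookup s i) ≡ 0
    magog⇒columnFree i = n≤0⇒n≡0 (+-cancelʳ-≤ 1 (S v) 0 (subst (_≤ 1) col≡Sv+1 col≤1))
      where
      S = afterRows noRows s (toℕ i)
      v = lookup s i
      v<n = magog⇒column<n i
      col≤1 : afterRows noRows s (suc (toℕ i)) v ≤ 1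
      col≤1 = subst (λ x → afterRows noRows s (suc (toℕ i)) x ≤ 1) (toℕ-fromℕ< v<n)
        (ℤ.drop‿+≤+ (subst (ℤ._≤ 1ℤ) (Col-rows s i (fromℕ< v<n)) (proj₂ (colPrefix i (fromℕ< v<n)))))
      col≡Sv+1 : afterRows noRows s (suc (toℕ i)) v ≡ S v + 1
      col≡Sv+1 = trans (afterRows-suc noRows s i v) (cong (λ b → S v + iverson b) (dec-true (v ≟ v) refl))

    magog⇒Admissible : ∀ i → Admissible (afterRows noRows s (toℕ i)) (lookup s i)
    magog⇒Admissible i j j+2<n with suc (toℕ i) ≟ n
    ... | yes 1+i≡n = begin
      S j                                   ≤⟨ m≤m+n (S j) _ ⟩
      addRow S v j                           ≡⟨ last-row j (2+m<n⇒m<n j+2<n) ⟩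
      1                                     ≡⟨ last-row (suc j) (2+m<n⇒1+m<n j+2<n) ⟨
      addRow S v (suc j)                     ≤⟨ m≤n+m _ (iverson (v ≤ᵇ j)) ⟩
      iverson (v ≤ᵇ j) + addRow S v (suc j)  ∎
      where
      open ≤-Reasoning
      S = afterRows noRows s (toℕ i)
      v = lookup s i
      last-row : ∀ x → x < n → addRow S v x ≡ 1
      last-row x x<n = trans (sym (afterRows-suc noRows s i x))
                         (trans (cong (λ m → afterRows noRows s m x) 1+i≡n) (magog⇒Full x x<n))
    ... | no 1+i≢n = interior (toℕ i) refl
      where
      j<n = 2+m<n⇒m<n j+2<n
      1+j<n = 2+m<n⇒1+m<n j+2<n
      interior : ∀ m → toℕ i ≡ m →
                 afterRows noRows s (toℕ i) j ≤ iverson (lookup s i ≤ᵇ j) + addRow (afterRows noRows s (toℕ i)) (lookup s i) (suc j)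
      interior zero    i≡0   = ≤-trans (≤-reflexive (cong (λ m → afterRows noRows s m j) i≡0)) z≤n
      interior (suc m) i≡1+m =
        Equivalence.to (magogIneq⇔Admissible s i≡1+i₀ (toℕ-fromℕ< j<n) (toℕ-fromℕ< 1+j<n))
          (magogIneq (fromℕ< m<n) (fromℕ< j<n) i (fromℕ< 1+j<n) i≡1+i₀
            (trans (toℕ-fromℕ< 1+j<n) (cong suc (sym (toℕ-fromℕ< j<n))))
            (≤∧≢⇒< (toℕ<n i) 1+i≢n)
            (subst (λ z → suc z < n) (sym (toℕ-fromℕ< 1+j<n)) j+2<n))
        where
        m<n : m < n
        m<n = <-trans (n<1+n m) (subst (_< n) i≡1+m (toℕ<n i))
        i≡1+i₀ : toℕ i ≡ suc (toℕ (fromℕ< m<n))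
        i≡1+i₀ = trans i≡1+m (cong suc (sym (toℕ-fromℕ< m<n)))

    magog⇒Valid : Valid noRows s
    magog⇒Valid = Step⇒Valid s (λ i → magog⇒column<n i , magog⇒columnFree i , magog⇒Admissible i) magog⇒Full

magog⇒rows : ∀ {n} {A : Matrix n} → IsMagog A → NoMinusOne A → ∃ λ s → A ≡ rows s
magog⇒rows {A = A} magog noMinusOne = 01-matrix⇒rows A entry01 (IsMagog.rowSum magog)
  where
  entry01 : ∀ i j → Is01 (entry A i j)
  entry01 i j with IsMagog.entries magog i j
  ... | inj₁ a≡0          = inj₁ a≡0
  ... | inj₂ (inj₁ a≡1)   = inj₂ a≡1
  ... | inj₂ (inj₂ a≡-1)  = contradiction a≡-1 (noMinusOne i j)

Unique-map⁺-on : ∀ {A B : Set} {P : A → Set} (f : A → B) {xs} → All P xs →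
                 (∀ {x y} → P x → P y → f x ≡ f y → x ≡ y) → Unique xs → Unique (List.map f xs)
Unique-map⁺-on f All.[]         _   AllPairs.[]          = AllPairs.[]
Unique-map⁺-on f (px All.∷ pxs) inj (x≢xs AllPairs.∷ uxs) =
  All.map⁺ (All.zipWith (λ (x≢y , py) fx≡fy → x≢y (inj px py fx≡fy)) (x≢xs , pxs))
  AllPairs.∷ Unique-map⁺-on f pxs inj uxs

module Enumeration (n : ℕ) where
  open Validity n
  open Stack n
  open Magog n

  magogColumns : List (Vec ℕ n)
  magogColumns = fillings n n []

  start≈noRows : occupied n [] ≈ noRows
  start≈noRows x x<n = occupied-below {n} {[]} x<n

  ∈-magogColumns⇒Valid : ∀ {s} → s ∈ magogColumns → Valid noRows s
  ∈-magogColumns⇒Valid s∈ = Valid-resp-≈ _ start≈noRows (fillings-sound n n [] ≤-refl tt s∈)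

  rows-magogColumns-unique : Unique (List.map rows magogColumns)
  rows-magogColumns-unique =
    Unique-map⁺-on rows (All.tabulate λ {s} s∈ i → proj₁ (Valid⇒Step s (∈-magogColumns⇒Valid s∈) i))
      (λ s<n _ → rows-injective _ _ s<n) (fillings-unique n n [] All.[])

  ∈-rows-magogColumns⇔magog : ∀ A → A ∈ List.map rows magogColumns ⇔ (IsMagog A × NoMinusOne A)
  ∈-rows-magogColumns⇔magog A = mk⇔ ∈⇒magog magog⇒∈
    where
    ∈⇒magog : A ∈ List.map rows magogColumns → IsMagog A × NoMinusOne A
    ∈⇒magog A∈ with ∈-map⁻ rows A∈
    ... | s , s∈ , refl = Valid⇒magog s (∈-magogColumns⇒Valid s∈)
    magog⇒∈ : IsMagog A × NoMinusOne A → A ∈ List.map rows magogColumns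
    magog⇒∈ (magog , noMinusOne) with magog⇒rows magog noMinusOne
    ... | s , refl = ∈-map⁺ rows (fillings-complete n n [] s ≤-refl tt
                       (Valid-resp-≈ s (λ x x<n → sym (start≈noRows x x<n)) (magog⇒Valid s magog)))

corollary3p6 : (n : ℕ) → 0 < n →
    Σ (List (Matrix n)) (λ L →
      Unique L × ((∀ (A : Matrix n) → (A ∈ L) ⇔ (IsMagog A × NoMinusOne A)) × length L ≡ catalan n))
corollary3p6 (suc a) _ =
  List.map rows magogColumns , rows-magogColumns-unique , ∈-rows-magogColumns⇔magog , length≡catalan
  where
  open Enumeration (suc a)
  length≡catalan : length (List.map rows magogColumns) ≡ catalan (suc a)
  length≡catalan = begin
    length (List.map rows magogColumns)  ≡⟨ List.length-map rows magogColumns ⟩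
    length magogColumns                  ≡⟨ length-fillings (suc a) (suc a) [] ⟩
    completions (suc a) (suc a) 0        ≡⟨ completions-catalan a ⟩
    catalan (suc a)                      ∎
    where open ≡-Reasoning
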